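{- Let $L$ be any of the fifteen logics of the modal cube. For every set of formulas $\Gamma$ and formula $\alpha$, if $\Gamma\vdash_L\alpha$ then $\Gamma\vDash^L\alpha$ (partial-semantic consequence).
   Context: Syntax and logics. Formulas: $\alpha ::= p \mid \bot \mid \alpha\to\alpha \mid \Box\alpha$; $\mathrm{For}$ is the set of formulas; $\neg\alpha:=\alpha\to\bot$, $\Diamond\alpha:=\neg\Box\neg\alpha$, $\wedge,\vee$ the usual classical abbreviations. $\mathbf K$: classical propositional axioms, (k) $\Box(\alpha\to\beta)\to(\Box\alpha\to\Box\beta)$, modus ponens, necessitation. Axiom schemes (D) $\Box\alpha\to\Diamond\alpha$, (T) $\Box\alpha\to\alpha$, (B) $\alpha\to\Box\Diamond\alpha$, (4) $\Box\alpha\to\Box\Box\alpha$, (5) $\Diamond\alpha\to\Box\Diamond\alpha$. The modal cube: $\mathbf K,\mathbf{KB},\mathbf{K4},\mathbf{K5},\mathbf{K45},\mathbf{KD},\mathbf{KDB},\mathbf{KD4},\mathbf{KD5},\mathbf{KD45},\mathbf{KT},\mathbf{KTB},\mathbf{S4}=\mathbf{KT4},\mathbf{S5}=\mathbf{KTB45},\mathbf{KB5}=\mathbf{KB45}$. $\Gamma\vdash_L\alpha$ means $\alpha$ or $(\gamma_1\wedge\dots\wedge\gamma_k)\to\alpha$ (some $\gamma_i\in\Gamma$) is a theorem of $L$. Truth values $\mathbf{F},\mathbf{f},\mathbf{f}_2,\mathbf{f}_3,\mathbf{t}_3,\mathbf{t}_2,\mathbf{t},\mathbf{T}$. Distinguished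 sets: $\mathcal D=\{\mathbf T,\mathbf t,\mathbf t_2,\mathbf t_3\}$ (designated), $N=\{\mathbf T,\mathbf t_2,\mathbf f_3,\mathbf f_2\}$, $I=\{\mathbf F,\mathbf f_2,\mathbf t_3,\mathbf t_2\}$, $P=\{\mathbf T,\mathbf t,\mathbf f_3,\mathbf f\}$, $PN=\{\mathbf F,\mathbf f,\mathbf t_3,\mathbf t\}$. Nmatrix $\mathcal M_L$. Values $V(L)$: all eight values for $\mathbf K,\mathbf{KB},\mathbf{K4},\mathbf{K5},\mathbf{K45}$; $\{\mathbf F,\mathbf f,\mathbf f_2,\mathbf t_2,\mathbf t,\mathbf T\}$ for $\mathbf{KB5}$; $\{\mathbf F,\mathbf f,\mathbf f_3,\mathbf t_3,\mathbf t,\mathbf T\}$ for $\mathbf{KD},\mathbf{KDB},\mathbf{KD4},\mathbf{KD5},\mathbf{KD45}$; $\{\mathbf F,\mathbf f,\mathbf t,\mathbf T\}$ for $\mathbf{KT},\mathbf{KTB},\mathbf{S4},\mathbf{S5}$. $\tilde\bot=\{\mathbf F,\mathbf f_2\}$. $\tilde\to(x,y)$, restricted to arguments in $V(L)$, listed for $y=\mathbf F,\mathbf f,\mathbf f_2,\mathbf f_3,\mathbf t_3,\mathbf t_2,\mathbf t,\mathbf T$: $x=\mathbf F$: $\{\mathbf T\}$ for all $y$; $x=\mathbf f$: $\{\mathbf t\},\{\mathbf T,\mathbf t\},\{\mathbf t_2\},\{\mathbf T\},\{\mathbf t\},\{\mathbf T\},\{\mathbf T,\mathbf t\},\{\mathbf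 T\}$; $x=\mathbf f_2$ and $x=\mathbf f_3$: $\{\mathbf t_3\},\{\mathbf t\},\{\mathbf t_2\},\{\mathbf T\},\{\mathbf t_3\},\{\mathbf t_2\},\{\mathbf t\},\{\mathbf T\}$; $x=\mathbf t_3$: $\{\mathbf f_3\}$ for $y\in\{\mathbf F,\mathbf f,\mathbf f_2,\mathbf f_3\}$, $\{\mathbf T\}$ otherwise; $x=\mathbf t_2$: $\{\mathbf F\},\{\mathbf f\},\{\mathbf f_2\},\{\mathbf f_3\},\{\mathbf t_3\},\{\mathbf t_2\},\{\mathbf t_3\},\{\mathbf T\}$; $x=\mathbf t$: $\{\mathbf f\},\{\mathbf f,\mathbf f_3\},\{\mathbf f_3\},\{\mathbf f_3\},\{\mathbf t\},\{\mathbf T\},\{\mathbf T,\mathbf t\},\{\mathbf T\}$; $x=\mathbf T$: $\{\mathbf F\},\{\mathbf f\},\{\mathbf f_2\},\{\mathbf f_3\},\{\mathbf t_3\},\{\mathbf t_2\},\{\mathbf t\},\{\mathbf T\}$. $\tilde\Box$ (argument $\mapsto$ output): $\mathbf K$: $\mathbf F,\mathbf f,\mathbf t_3,\mathbf t\mapsto\{\mathbf F,\mathbf f,\mathbf f_3\}$; $\mathbf f_2,\mathbf t_2\mapsto\{\mathbf t_2\}$; $\mathbf f_3,\mathbf T\mapsto\{\mathbf T,\mathbf t,\mathbf t_3\}$. $\mathbf{KB}$: $\mathbf F,\mathbf f\mapsto\{\mathbf F\}$; $\mathbf f_2,\mathbf t_2\mapsto\{\mathbf t_2\}$; $\mathbf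 f_3\mapsto\{\mathbf t_3\}$; $\mathbf t_3,\mathbf t\mapsto\{\mathbf F,\mathbf f,\mathbf f_3\}$; $\mathbf T\mapsto\{\mathbf T,\mathbf t,\mathbf t_3\}$. $\mathbf{K4}$: $\mathbf F,\mathbf f,\mathbf t_3,\mathbf t\mapsto\{\mathbf F,\mathbf f,\mathbf f_3\}$; $\mathbf f_2,\mathbf t_2\mapsto\{\mathbf t_2\}$; $\mathbf f_3,\mathbf T\mapsto\{\mathbf T\}$. $\mathbf{K5}$: $\mathbf F,\mathbf f,\mathbf t_3,\mathbf t\mapsto\{\mathbf F\}$; $\mathbf f_2,\mathbf t_2\mapsto\{\mathbf t_2\}$; $\mathbf f_3,\mathbf T\mapsto\{\mathbf T,\mathbf t_3\}$. $\mathbf{K45}$: $\mathbf F,\mathbf f,\mathbf t_3,\mathbf t\mapsto\{\mathbf F\}$; $\mathbf f_2,\mathbf t_2\mapsto\{\mathbf t_2\}$; $\mathbf f_3,\mathbf T\mapsto\{\mathbf T\}$. $\mathbf{KB5}$: $\mathbf F,\mathbf f,\mathbf t\mapsto\{\mathbf F\}$; $\mathbf f_2,\mathbf t_2\mapsto\{\mathbf t_2\}$; $\mathbf T\mapsto\{\mathbf T\}$. $\mathbf{KD}$: $\mathbf F,\mathbf f,\mathbf t_3,\mathbf t\mapsto\{\mathbf F,\mathbf f,\mathbf f_3\}$; $\mathbf f_3,\mathbf T\mapsto\{\mathbf T,\mathbf t,\mathbf t_3\}$. $\mathbf{KDB}$: $\mathbf F,\mathbf f\mapsto\{\mathbf F\}$;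 $\mathbf f_3\mapsto\{\mathbf t_3\}$; $\mathbf t_3,\mathbf t\mapsto\{\mathbf F,\mathbf f,\mathbf f_3\}$; $\mathbf T\mapsto\{\mathbf T,\mathbf t,\mathbf t_3\}$. $\mathbf{KD4}$: $\mathbf F,\mathbf t_3\mapsto\{\mathbf F\}$; $\mathbf f,\mathbf t\mapsto\{\mathbf F,\mathbf f,\mathbf f_3\}$; $\mathbf f_3,\mathbf T\mapsto\{\mathbf T\}$. $\mathbf{KD5}$: $\mathbf F,\mathbf f,\mathbf t_3,\mathbf t\mapsto\{\mathbf F\}$; $\mathbf f_3,\mathbf T\mapsto\{\mathbf T,\mathbf t_3\}$. $\mathbf{KD45}$: $\mathbf F,\mathbf f,\mathbf t_3,\mathbf t\mapsto\{\mathbf F\}$; $\mathbf f_3,\mathbf T\mapsto\{\mathbf T\}$. $\mathbf{KT}$: $\mathbf F\mapsto\{\mathbf F\}$; $\mathbf f,\mathbf t\mapsto\{\mathbf F,\mathbf f\}$; $\mathbf T\mapsto\{\mathbf T,\mathbf t\}$. $\mathbf{KTB}$: $\mathbf F,\mathbf f\mapsto\{\mathbf F\}$; $\mathbf t\mapsto\{\mathbf F,\mathbf f\}$; $\mathbf T\mapsto\{\mathbf T,\mathbf t\}$. $\mathbf{S4}$: $\mathbf F\mapsto\{\mathbf F\}$; $\mathbf f,\mathbf t\mapsto\{\mathbf F,\mathbf f\}$; $\mathbf T\mapsto\{\mathbf T\}$. $\mathbf{S5}$: $\mathbf F,\mathbf f,\mathbf t\mapsto\{\mathbf F\}$; $\mathbf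 T\mapsto\{\mathbf T\}$. Partial valuations: for $\Lambda$ closed under subformulas, $[\Lambda\to V]_{\mathcal M_L}$ is the set of maps $v:\Lambda\to V(L)$ with $v(\bot)\in\tilde\bot$, $v(\beta\to\gamma)\in\tilde\to(v(\beta),v(\gamma))$, $v(\Box\beta)\in\tilde\Box(v(\beta))$ whenever these formulas lie in $\Lambda$. Models: a pre-model on $\Lambda$ is a pair $\langle\Pi,R\rangle$ with $\Pi\subseteq[\Lambda\to V]_{\mathcal M_L}$ and $R\subseteq\Pi\times\Pi$ such that for all $v\in\Pi$, $\beta\in\Lambda$: if $v(\beta)\in P$ there is $w\in\Pi$ with $vRw$ and $w(\beta)\in\mathcal D$; if $v(\beta)\in PN$ there is $w\in\Pi$ with $vRw$ and $w(\beta)\notin\mathcal D$. A $\mathbf K$-model is a pre-model such that whenever $vRw$: $v(\beta)\in N\Rightarrow w(\beta)\in\mathcal D$ and $v(\beta)\in I\Rightarrow w(\beta)\notin\mathcal D$. An $L$-model is a $\mathbf K$-model satisfying, for each axiom scheme among (T),(D),(B),(4),(5) that holds in $L$, the following conditions for all $v,w,w'\in\Pi$, $\beta\in\Lambda$: (T): $v(\beta)\in N\Rightarrow v(\beta)\in\mathcal D$, and $v(\beta)\in I\Rightarrow v(\beta)\notin\mathcal D$; (D): $v(\beta)\in N\Rightarrow v(\beta)\in P$, and $v(\beta)\in I\Rightarrow v(\beta)\in PN$; (B): if $vRw$, then $v(\beta)\in\mathcal D\Rightarrow w(\beta)\in P$ and $v(\beta)\notin\mathcal D\Rightarrow w(\beta)\in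 PN$; (4): if $vRw$, then $v(\beta)\in N\Rightarrow w(\beta)\in N$ and $v(\beta)\in I\Rightarrow w(\beta)\in I$; (5): if $vRw$, then $v(\beta)\in P\Rightarrow w(\beta)\in P$ and $v(\beta)\in PN\Rightarrow w(\beta)\in PN$; moreover if $v(\beta),w(\beta)\in N$, $vRw$ and ($vRw'$ or $wRw'$) then $w'(\beta)\in N$, and likewise with $I$ in place of $N$. A partial valuation $v$ is a partial level-valuation (for $L$) if $v\in\Pi$ for some $L$-model $\langle\Pi,R\rangle$. Partial-semantic consequence: writing $\overline{\Gamma\cup\{\alpha\}}$ for the smallest set containing $\Gamma\cup\{\alpha\}$ closed under subformulas, $\Gamma\vDash^L\alpha$ holds iff for every partial level-valuation $v$ with domain $\overline{\Gamma\cup\{\alpha\}}$: if $v(\beta)\in\mathcal D$ for all $\beta\in\Gamma$ then $v(\alpha)\in\mathcal D$. -}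

module Defs where

open import Level using (Level; 0ℓ)
open import Data.Nat using (ℕ)
open import Data.Bool using (Bool; true; false; T)
open import Data.Unit using (⊤)
open import Data.Empty using (⊥)
open import Data.Product using (Σ; ∃; _×_; _,_)
open import Data.Sum using (_⊎_)
open import Data.List using (List; []; _∷_)
open import Data.List.Membership.Propositional using (_∈_)
open import Data.List.Relation.Unary.All using (All)
open import Relation.Binary.PropositionalEquality using (_≡_)

infixr 6 _⇒_

data For : Set where
  var : ℕ → For
  ⊥' : For
  _⇒_ : For → For → For
  □ : For → For

¬' : For → For
¬' a = a ⇒ ⊥'

◇ : For → For
◇ a = ¬' (□ (¬' a))

_∧'_ : For → For → For
a ∧' b = ¬' (a ⇒ ¬' b)

_∨'_ : For → For → For
a ∨' b = ¬' a ⇒ b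

conj : For → List For → For
conj g [] = g
conj g (h ∷ hs) = g ∧' conj h hs

data Logic : Set where
  K KB K4 K5 K45 KD KDB KD4 KD5 KD45 KT KTB S4 S5 KB5 : Logic

-- Axiom schemes used in the *axiomatization* named by the logic
-- (KT = K+T, S4 = KT4, S5 = KTB45, KB5 = KB45, ...)
axT axD axB ax4 ax5 : Logic → Bool
axT KT = true
axT KTB = true
axT S4 = true
axT S5 = true
axT _ = false

axD KD = true
axD KDB = true
axD KD4 = true
axD KD5 = true
axD KD45 = true
axD _ = false

axB KB = true
axB KDB = true
axB KTB = true
axB S5 = true
axB KB5 = true
axB _ = false

ax4 K4 = true
ax4 K45 = true
ax4 KD4 = true
ax4 KD45 = true
ax4 S4 = true
ax4 S5 = true
ax4 KB5 = true
ax4 _ = false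

ax5 K5 = true
ax5 K45 = true
ax5 KD5 = true
ax5 KD45 = true
ax5 S5 = true
ax5 KB5 = true
ax5 _ = false

data Thm (L : Logic) : For → Set where
  A1  : ∀ a b → Thm L (a ⇒ (b ⇒ a))
  A2  : ∀ a b c → Thm L ((a ⇒ (b ⇒ c)) ⇒ ((a ⇒ b) ⇒ (a ⇒ c)))
  A3  : ∀ a → Thm L (¬' (¬' a) ⇒ a)
  Ak  : ∀ a b → Thm L (□ (a ⇒ b) ⇒ (□ a ⇒ □ b))
  AT  : T (axT L) → ∀ a → Thm L (□ a ⇒ a)
  AD  : T (axD L) → ∀ a → Thm L (□ a ⇒ ◇ a)
  AB  : T (axB L) → ∀ a → Thm L (a ⇒ □ (◇ a))
  A4  : T (ax4 L) → ∀ a → Thm L (□ a ⇒ □ (□ a))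
  A5  : T (ax5 L) → ∀ a → Thm L (◇ a ⇒ □ (◇ a))
  MP  : ∀ {a b} → Thm L (a ⇒ b) → Thm L a → Thm L b
  Nec : ∀ {a} → Thm L a → Thm L (□ a)

FSet : Set₁
FSet = For → Set

_⊢[_]_ : FSet → Logic → For → Set
Γ ⊢[ L ] a = Thm L a ⊎ Σ For (λ g → Σ (List For) (λ gs →
               Γ g × All Γ gs × Thm L (conj g gs ⇒ a)))

data Val : Set where
  vF vf vf2 vf3 vt3 vt2 vt vT : Val

inV : Logic → Val → Bool
inV KB5 vf3 = false
inV KB5 vt3 = false
inV KD vf2 = false
inV KD vt2 = false
inV KDB vf2 = false
inV KDB vt2 = false
inV KD4 vf2 = false
inV KD4 vt2 = false
inV KD5 vf2 = false
inV KD5 vt2 = false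
inV KD45 vf2 = false
inV KD45 vt2 = false
inV KT vF = true
inV KT vf = true
inV KT vt = true
inV KT vT = true
inV KT _ = false
inV KTB vF = true
inV KTB vf = true
inV KTB vt = true
inV KTB vT = true
inV KTB _ = false
inV S4 vF = true
inV S4 vf = true
inV S4 vt = true
inV S4 vT = true
inV S4 _ = false
inV S5 vF = true
inV S5 vf = true
inV S5 vt = true
inV S5 vT = true
inV S5 _ = false
inV _ _ = true

isD isN isI isP isPN : Val → Bool
isD vT = true
isD vt = true
isD vt2 = true
isD vt3 = true
isD _ = false

isN vT = true
isN vt2 = true
isN vf3 = true
isN vf2 = true
isN _ = false

isI vF = true
isI vf2 = true
isI vt3 = true
isI vt2 = true
isI _ = false

isP vT = true
isP vt = true
isP vf3 = true
isP vf = true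
isP _ = false

isPN vF = true
isPN vf = true
isPN vt3 = true
isPN vt = true
isPN _ = false

Des N' I' P' PN' : Val → Set
Des x = T (isD x)
N' x = T (isN x)
I' x = T (isI x)
P' x = T (isP x)
PN' x = T (isPN x)

botSet : List Val
botSet = vF ∷ vf2 ∷ []

row23 : Val → List Val
row23 vF = vt3 ∷ []
row23 vf = vt ∷ []
row23 vf2 = vt2 ∷ []
row23 vf3 = vT ∷ []
row23 vt3 = vt3 ∷ []
row23 vt2 = vt2 ∷ []
row23 vt = vt ∷ []
row23 vT = vT ∷ []

impSet : Val → Val → List Val
impSet vF _ = vT ∷ []
impSet vf vF = vt ∷ []
impSet vf vf = vT ∷ vt ∷ []
impSet vf vf2 = vt2 ∷ []
impSet vf vf3 = vT ∷ []
impSet vf vt3 = vt ∷ []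
impSet vf vt2 = vT ∷ []
impSet vf vt = vT ∷ vt ∷ []
impSet vf vT = vT ∷ []
impSet vf2 y = row23 y
impSet vf3 y = row23 y
impSet vt3 vF = vf3 ∷ []
impSet vt3 vf = vf3 ∷ []
impSet vt3 vf2 = vf3 ∷ []
impSet vt3 vf3 = vf3 ∷ []
impSet vt3 _ = vT ∷ []
impSet vt2 vF = vF ∷ []
impSet vt2 vf = vf ∷ []
impSet vt2 vf2 = vf2 ∷ []
impSet vt2 vf3 = vf3 ∷ []
impSet vt2 vt3 = vt3 ∷ []
impSet vt2 vt2 = vt2 ∷ []
impSet vt2 vt = vt3 ∷ []
impSet vt2 vT = vT ∷ []
impSet vt vF = vf ∷ []
impSet vt vf = vf ∷ vf3 ∷ []
impSet vt vf2 = vf3 ∷ []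
impSet vt vf3 = vf3 ∷ []
impSet vt vt3 = vt ∷ []
impSet vt vt2 = vT ∷ []
impSet vt vt = vT ∷ vt ∷ []
impSet vt vT = vT ∷ []
impSet vT y = y ∷ []

lowK highK : List Val
lowK = vF ∷ vf ∷ vf3 ∷ []
highK = vT ∷ vt ∷ vt3 ∷ []

boxSet : Logic → Val → List Val
boxSet K vF = lowK
boxSet K vf = lowK
boxSet K vt3 = lowK
boxSet K vt = lowK
boxSet K vf2 = vt2 ∷ []
boxSet K vt2 = vt2 ∷ []
boxSet K vf3 = highK
boxSet K vT = highK
boxSet KB vF = vF ∷ []
boxSet KB vf = vF ∷ []
boxSet KB vf2 = vt2 ∷ []
boxSet KB vt2 = vt2 ∷ []
boxSet KB vf3 = vt3 ∷ []
boxSet KB vt3 = lowK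
boxSet KB vt = lowK
boxSet KB vT = highK
boxSet K4 vF = lowK
boxSet K4 vf = lowK
boxSet K4 vt3 = lowK
boxSet K4 vt = lowK
boxSet K4 vf2 = vt2 ∷ []
boxSet K4 vt2 = vt2 ∷ []
boxSet K4 vf3 = vT ∷ []
boxSet K4 vT = vT ∷ []
boxSet K5 vF = vF ∷ []
boxSet K5 vf = vF ∷ []
boxSet K5 vt3 = vF ∷ []
boxSet K5 vt = vF ∷ []
boxSet K5 vf2 = vt2 ∷ []
boxSet K5 vt2 = vt2 ∷ []
boxSet K5 vf3 = vT ∷ vt3 ∷ []
boxSet K5 vT = vT ∷ vt3 ∷ []
boxSet K45 vF = vF ∷ []
boxSet K45 vf = vF ∷ []
boxSet K45 vt3 = vF ∷ []
boxSet K45 vt = vF ∷ []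
boxSet K45 vf2 = vt2 ∷ []
boxSet K45 vt2 = vt2 ∷ []
boxSet K45 vf3 = vT ∷ []
boxSet K45 vT = vT ∷ []
boxSet KB5 vF = vF ∷ []
boxSet KB5 vf = vF ∷ []
boxSet KB5 vt = vF ∷ []
boxSet KB5 vf2 = vt2 ∷ []
boxSet KB5 vt2 = vt2 ∷ []
boxSet KB5 vT = vT ∷ []
boxSet KB5 _ = []
boxSet KD vF = lowK
boxSet KD vf = lowK
boxSet KD vt3 = lowK
boxSet KD vt = lowK
boxSet KD vf3 = highK
boxSet KD vT = highK
boxSet KD _ = []
boxSet KDB vF = vF ∷ []
boxSet KDB vf = vF ∷ []
boxSet KDB vf3 = vt3 ∷ []
boxSet KDB vt3 = lowK
boxSet KDB vt = lowK
boxSet KDB vT = highK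
boxSet KDB _ = []
boxSet KD4 vF = vF ∷ []
boxSet KD4 vt3 = vF ∷ []
boxSet KD4 vf = lowK
boxSet KD4 vt = lowK
boxSet KD4 vf3 = vT ∷ []
boxSet KD4 vT = vT ∷ []
boxSet KD4 _ = []
boxSet KD5 vF = vF ∷ []
boxSet KD5 vf = vF ∷ []
boxSet KD5 vt3 = vF ∷ []
boxSet KD5 vt = vF ∷ []
boxSet KD5 vf3 = vT ∷ vt3 ∷ []
boxSet KD5 vT = vT ∷ vt3 ∷ []
boxSet KD5 _ = []
boxSet KD45 vF = vF ∷ []
boxSet KD45 vf = vF ∷ []
boxSet KD45 vt3 = vF ∷ []
boxSet KD45 vt = vF ∷ []
boxSet KD45 vf3 = vT ∷ []
boxSet KD45 vT = vT ∷ []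
boxSet KD45 _ = []
boxSet KT vF = vF ∷ []
boxSet KT vf = vF ∷ vf ∷ []
boxSet KT vt = vF ∷ vf ∷ []
boxSet KT vT = vT ∷ vt ∷ []
boxSet KT _ = []
boxSet KTB vF = vF ∷ []
boxSet KTB vf = vF ∷ []
boxSet KTB vt = vF ∷ vf ∷ []
boxSet KTB vT = vT ∷ vt ∷ []
boxSet KTB _ = []
boxSet S4 vF = vF ∷ []
boxSet S4 vf = vF ∷ vf ∷ []
boxSet S4 vt = vF ∷ vf ∷ []
boxSet S4 vT = vT ∷ []
boxSet S4 _ = []
boxSet S5 vF = vF ∷ []
boxSet S5 vf = vF ∷ []
boxSet S5 vt = vF ∷ []
boxSet S5 vT = vT ∷ []
boxSet S5 _ = []

-- A partial valuation with domain Λ (a set of formulas closed under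
-- subformulas) is represented by a total map For → Val of which only the
-- values on Λ matter: all conditions below only inspect formulas in Λ.

Valuation : Set
Valuation = For → Val

IsPartialValuation : Logic → FSet → Valuation → Set
IsPartialValuation L Λ v =
  (∀ b → Λ b → T (inV L (v b))) ×
  (Λ ⊥' → v ⊥' ∈ botSet) ×
  (∀ b c → Λ (b ⇒ c) → v (b ⇒ c) ∈ impSet (v b) (v c)) ×
  (∀ b → Λ (□ b) → v (□ b) ∈ boxSet L (v b))

VSet : Set₁
VSet = Valuation → Set

VRel : Set₁
VRel = Valuation → Valuation → Set

IsPreModel : Logic → FSet → VSet → VRel → Set
IsPreModel L Λ Π R =
  (∀ v → Π v → IsPartialValuation L Λ v) ×
  (∀ v w → R v w → Π v × Π w) ×
  (∀ v b → Π v → Λ b → P' (v b) → Σ Valuation λ w → Π w × R v w × Des (w b)) ×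
  (∀ v b → Π v → Λ b → PN' (v b) → Σ Valuation λ w → Π w × R v w × (Des (w b) → ⊥))

IsKModel : Logic → FSet → VSet → VRel → Set
IsKModel L Λ Π R = IsPreModel L Λ Π R ×
  (∀ v w b → Π v → Π w → Λ b → R v w →
     (N' (v b) → Des (w b)) × (I' (v b) → Des (w b) → ⊥))

CondT CondD CondB Cond4 Cond5 : FSet → VSet → VRel → Set
CondT Λ Π R = ∀ v b → Π v → Λ b →
  (N' (v b) → Des (v b)) × (I' (v b) → Des (v b) → ⊥)
CondD Λ Π R = ∀ v b → Π v → Λ b →
  (N' (v b) → P' (v b)) × (I' (v b) → PN' (v b))
CondB Λ Π R = ∀ v w b → Π v → Π w → Λ b → R v w →
  (Des (v b) → P' (w b)) × ((Des (v b) → ⊥) → PN' (w b))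
Cond4 Λ Π R = ∀ v w b → Π v → Π w → Λ b → R v w →
  (N' (v b) → N' (w b)) × (I' (v b) → I' (w b))
Cond5 Λ Π R =
  (∀ v w b → Π v → Π w → Λ b → R v w →
     (P' (v b) → P' (w b)) × (PN' (v b) → PN' (w b))) ×
  (∀ v w w' b → Π v → Π w → Π w' → Λ b → R v w → (R v w' ⊎ R w w') →
     (N' (v b) → N' (w b) → N' (w' b)) × (I' (v b) → I' (w b) → I' (w' b)))

holdsT holdsD holdsB holds4 holds5 : Logic → Bool
holdsT L = axT L
holdsD KT = true
holdsD KTB = true
holdsD S4 = true
holdsD S5 = true
holdsD L = axD L
holdsB L = axB L
holds4 L = ax4 L
holds5 L = ax5 L

when : Bool → Set → Set
when true A = A
when false A = ⊤

IsLModel : Logic → FSet → VSet → VRel → Set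
IsLModel L Λ Π R = IsKModel L Λ Π R ×
  when (holdsT L) (CondT Λ Π R) ×
  when (holdsD L) (CondD Λ Π R) ×
  when (holdsB L) (CondB Λ Π R) ×
  when (holds4 L) (Cond4 Λ Π R) ×
  when (holds5 L) (Cond5 Λ Π R)

IsLevelValuation : Logic → FSet → Valuation → Set₁
IsLevelValuation L Λ v = Σ VSet λ Π → Σ VRel λ R → IsLModel L Λ Π R × Π v

data SubOf : For → For → Set where
  sub-refl : ∀ {a} → SubOf a a
  sub-impl : ∀ {a b c} → SubOf a b → SubOf a (b ⇒ c)
  sub-impr : ∀ {a b c} → SubOf a c → SubOf a (b ⇒ c)
  sub-box  : ∀ {a b} → SubOf a b → SubOf a (□ b)

closure : FSet → For → FSet
closure Γ a b = Σ For λ g → (Γ g ⊎ g ≡ a) × SubOf b g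

_⊨[_]_ : FSet → Logic → For → Set₁
Γ ⊨[ L ] a = ∀ (v : Valuation) → IsLevelValuation L (closure Γ a) v →
  (∀ g → Γ g → Des (v g)) → Des (v a)

module Submission where

-- Read an L-model (Π, R) on Λ as a Kripke model whose worlds are the valuations in Π and
-- in which an atom holds at v iff v designates it. In ℳ_L, ⊥ and → behave classically
-- with respect to 𝒟, and □b is designated at v iff v(b) ∈ N. So if every successor of v
-- designates the members of Λ that v marks N and undesignates those it marks I, the
-- PN-witnesses of the model make Kripke truth agree with designation on Λ. R itself need
-- not satisfy the frame conditions of L; it is enlarged to a relation Access L ⊇ R of
-- such successors that does. The Hilbert calculus for L is sound on that frame, hence
-- Γ ⊢_L α forces v(α) ∈ 𝒟 whenever v designates Γ.

open import Data.Bool using (Bool; true; false; T; not; _∨_)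
open import Data.Bool.Properties using (T?; _≟_)
open import Data.Empty using (⊥; ⊥-elim)
open import Data.List using (List; []; _∷_)
open import Data.List.Membership.Propositional using (_∈_)
open import Data.List.Relation.Unary.All as All using (All; []; _∷_; all?; lookup; tabulate)
open import Data.List.Relation.Unary.Any using (here; there)
open import Data.Nat using (ℕ)
open import Data.Product using (Σ; ∃; _×_; _,_; proj₁; proj₂; swap)
open import Data.Sum using (_⊎_; inj₁; inj₂; [_,_])
open import Data.Unit using (⊤; tt)
open import Function using (id; _∘_; flip)
open import Function.Bundles using (_⇔_; mk⇔; Equivalence)
open import Relation.Binary.Construct.Intersection using (_∩_)
open import Relation.Binary.Definitions using (Reflexive; Symmetric; Transitive)
open import Relation.Binary.PropositionalEquality using (_≡_; refl; sym; subst)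
open import Relation.Nullary using (¬_; Dec; yes; no)
open import Relation.Nullary.Decidable using (from-yes; decidable-stable; ¬?; map′)
open import Relation.Unary using (Decidable)

open import Defs

open Equivalence using (to; from)

-- Kripke semantics

Euclidean : {W : Set} → (W → W → Set) → Set
Euclidean _≺_ = ∀ {w u x} → w ≺ u → w ≺ x → u ≺ x

record IsFrameFor (L : Logic) {W : Set} (_≺_ : W → W → Set) : Set where
  constructor isFrameFor
  field
    reflexive  : when (axT L) (Reflexive _≺_)
    serial     : when (axD L) (∀ w → ∃ (w ≺_))
    symmetric  : when (axB L) (Symmetric _≺_)
    transitive : when (ax4 L) (Transitive _≺_)
    euclidean  : when (ax5 L) (Euclidean _≺_)

when-elim : ∀ {b A} → T b → when b A → A
when-elim {true} _ a = a

module Kripke {W : Set} (_≺_ : W → W → Set) (atom : W → ℕ → Bool) where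

  infix 4 _⊩_
  _⊩_ : W → For → Set
  w ⊩ var n = T (atom w n)
  w ⊩ ⊥'    = ⊥
  w ⊩ a ⇒ b = w ⊩ a → w ⊩ b
  w ⊩ □ a   = ∀ {u} → w ≺ u → u ⊩ a

  ⊩-stable : ∀ w a → ¬ ¬ w ⊩ a → w ⊩ a
  ⊩-stable w (var n)        = decidable-stable (T? (atom w n))
  ⊩-stable w ⊥'      ¬¬⊥    = ¬¬⊥ id
  ⊩-stable w (a ⇒ b) ¬¬f x  = ⊩-stable w b λ ¬b → ¬¬f λ f → ¬b (f x)
  ⊩-stable w (□ a)   ¬¬h wu = ⊩-stable _ a λ ¬a → ¬¬h λ h → ¬a (h wu)

  module _ {L : Logic} (F : IsFrameFor L _≺_) where
    open IsFrameFor F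

    valid : ∀ {φ} → Thm L φ → ∀ w → w ⊩ φ
    valid (A1 a b)   w = λ x _ → x
    valid (A2 a b c) w = λ f g x → f x (g x)
    valid (A3 a)     w = ⊩-stable w a
    valid (Ak a b)   w = λ f g wu → f wu (g wu)
    valid (AT t a)   w = λ h → h (when-elim t reflexive)
    valid (AD d a)   w = λ h ¬◇ → let (_ , wu) = when-elim d serial w in ¬◇ wu (h wu)
    valid (AB b a)   w = λ x wu ¬◇ → ¬◇ (when-elim b symmetric wu) x
    valid (A4 t a)   w = λ h wu ux → h (when-elim t transitive wu ux)
    valid (A5 e a)   w = λ ◇a wu ¬◇ → ◇a λ wx → ¬◇ (when-elim e euclidean wu wx)
    valid (MP d e)   w = valid d w (valid e w)
    valid (Nec d)    w = λ _ → valid d _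

    ⊩-conj : ∀ {w g} gs → w ⊩ g → All (w ⊩_) gs → w ⊩ conj g gs
    ⊩-conj []       wg []         = wg
    ⊩-conj (h ∷ hs) wg (wh ∷ whs) = λ ¬∧ → ¬∧ wg (⊩-conj hs wh whs)

    ⊢-sound : ∀ {Γ α} → Γ ⊢[ L ] α → ∀ w → (∀ {g} → Γ g → w ⊩ g) → w ⊩ α
    ⊢-sound (inj₁ ⊢α) w _ = valid ⊢α w
    ⊢-sound (inj₂ (g , gs , Γg , Γgs , ⊢conj⇒α)) w Γ-true =
      valid ⊢conj⇒α w (⊩-conj gs (Γ-true Γg) (All.map Γ-true Γgs))

-- The truth tables of ℳ_L

every? : {A : Set} {P : A → Set} (xs : List A) → (∀ x → x ∈ xs) →
         Decidable P → Dec (∀ x → P x)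
every? xs complete P? =
  map′ (λ all x → lookup all (complete x)) (λ f → tabulate (λ {x} _ → f x)) (all? P? xs)

values : List Val
values = vF ∷ vf ∷ vf2 ∷ vf3 ∷ vt3 ∷ vt2 ∷ vt ∷ vT ∷ []

∈-values : ∀ x → x ∈ values
∈-values vF  = here refl
∈-values vf  = there (here refl)
∈-values vf2 = there (there (here refl))
∈-values vf3 = there (there (there (here refl)))
∈-values vt3 = there (there (there (there (here refl))))
∈-values vt2 = there (there (there (there (there (here refl)))))
∈-values vt  = there (there (there (there (there (there (here refl))))))
∈-values vT  = there (there (there (there (there (there (there (here refl)))))))

every-value? : {P : Val → Set} → Decidable P → Dec (∀ x → P x)
every-value? = every? values ∈-values

isD-impSet : ∀ x y → All (λ z → isD z ≡ not (isD x) ∨ isD y) (impSet x y)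
isD-impSet = from-yes (every-value? λ x → every-value? λ y →
  all? (λ z → isD z ≟ not (isD x) ∨ isD y) (impSet x y))

isD-boxSet? : ∀ L → Dec (∀ x → All (λ z → isD z ≡ isN x) (boxSet L x))
isD-boxSet? L = every-value? λ x → all? (λ z → isD z ≟ isN x) (boxSet L x)

isD-boxSet : ∀ L x → All (λ z → isD z ≡ isN x) (boxSet L x)
isD-boxSet K    = from-yes (isD-boxSet? K)
isD-boxSet KB   = from-yes (isD-boxSet? KB)
isD-boxSet K4   = from-yes (isD-boxSet? K4)
isD-boxSet K5   = from-yes (isD-boxSet? K5)
isD-boxSet K45  = from-yes (isD-boxSet? K45)
isD-boxSet KD   = from-yes (isD-boxSet? KD)
isD-boxSet KDB  = from-yes (isD-boxSet? KDB)
isD-boxSet KD4  = from-yes (isD-boxSet? KD4)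
isD-boxSet KD5  = from-yes (isD-boxSet? KD5)
isD-boxSet KD45 = from-yes (isD-boxSet? KD45)
isD-boxSet KT   = from-yes (isD-boxSet? KT)
isD-boxSet KTB  = from-yes (isD-boxSet? KTB)
isD-boxSet S4   = from-yes (isD-boxSet? S4)
isD-boxSet S5   = from-yes (isD-boxSet? S5)
isD-boxSet KB5  = from-yes (isD-boxSet? KB5)

isPN≡not∘isN : ∀ x → isPN x ≡ not (isN x)
isPN≡not∘isN = from-yes (every-value? λ x → isPN x ≟ not (isN x))

isP≡not∘isI : ∀ x → isP x ≡ not (isI x)
isP≡not∘isI = from-yes (every-value? λ x → isP x ≟ not (isI x))

T-not : ∀ {a b} → a ≡ not b → T a ⇔ (¬ T b)
T-not {b = true}  refl = mk⇔ (λ ()) (λ ¬⊤ → ¬⊤ tt)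
T-not {b = false} refl = mk⇔ (λ _ ()) (λ _ → tt)

T-implication : ∀ a b → T (not a ∨ b) ⇔ (T a → T b)
T-implication true  b = mk⇔ (λ b _ → b) (λ f → f tt)
T-implication false b = mk⇔ (λ _ ()) (λ _ → tt)

⊥-undesignated : ∀ {z} → z ∈ botSet → ¬ Des z
⊥-undesignated (here refl) ()
⊥-undesignated (there (here refl)) ()

Des-⇒ : ∀ {x y z} → z ∈ impSet x y → Des z ⇔ (Des x → Des y)
Des-⇒ {x} {y} z∈ = subst (λ d → T d ⇔ (Des x → Des y)) (sym (lookup (isD-impSet x y) z∈))
                          (T-implication (isD x) (isD y))

Des-□ : ∀ {L x z} → z ∈ boxSet L x → Des z ⇔ N' x
Des-□ {L} {x} z∈ = subst (λ d → T d ⇔ N' x) (sym (lookup (isD-boxSet L x) z∈)) (mk⇔ id id)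

-- Each condition on models is a pair of dual clauses, one about N, P and 𝒟 and one about
-- I, PN and the complement of 𝒟; a polarity selects one of them.

data Polarity : Set where
  pos neg : Polarity

opposite : Polarity → Polarity
opposite pos = neg
opposite neg = pos

Necessary Possible Holds : Polarity → Val → Set
Necessary pos = N'
Necessary neg = I'
Possible pos = P'
Possible neg = PN'
Holds pos x = Des x
Holds neg x = ¬ Des x

Necessary? : ∀ s x → Dec (Necessary s x)
Necessary? pos x = T? (isN x)
Necessary? neg x = T? (isI x)

Holds? : ∀ s x → Dec (Holds s x)
Holds? pos x = T? (isD x)
Holds? neg x = ¬? (T? (isD x))

Possible-opposite⇔¬Necessary : ∀ s x → Possible (opposite s) x ⇔ (¬ Necessary s x)
Possible-opposite⇔¬Necessary pos x = T-not (isPN≡not∘isN x)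
Possible-opposite⇔¬Necessary neg x = T-not (isP≡not∘isI x)

¬Holds⇒Holds-opposite : ∀ s x → ¬ Holds s x → Holds (opposite s) x
¬Holds⇒Holds-opposite pos x = id
¬Holds⇒Holds-opposite neg x = decidable-stable (T? (isD x))

-- Accessibility relations built from an L-model

module Marks (Λ : FSet) where

  KCompatible _≼_ _≈_ : Valuation → Valuation → Set
  KCompatible v w = ∀ s {b} → Λ b → Necessary s (v b) → Holds s (w b)
  v ≼ w = ∀ s {b} → Λ b → Necessary s (v b) → Necessary s (w b)
  v ≈ w = v ≼ w × w ≼ v

  ≼-refl : Reflexive _≼_
  ≼-refl s _ = id

  ≼-trans : Transitive _≼_
  ≼-trans v≼w w≼u s Λb = w≼u s Λb ∘ v≼w s Λb

  ≈-refl : Reflexive _≈_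
  ≈-refl = ≼-refl , ≼-refl

  ≈-sym : Symmetric _≈_
  ≈-sym = swap

  ≈-trans : Transitive _≈_
  ≈-trans (v≼w , w≼v) (w≼u , u≼w) = ≼-trans v≼w w≼u , ≼-trans u≼w w≼v

  ≼-KCompatible-trans : ∀ {v w u} → v ≼ w → KCompatible w u → KCompatible v u
  ≼-KCompatible-trans v≼w w→u s Λb = w→u s Λb ∘ v≼w s Λb

  ≼-compatible-trans : Transitive (KCompatible ∩ _≼_)
  ≼-compatible-trans (v→w , v≼w) (w→u , w≼u) =
    ≼-KCompatible-trans v≼w w→u , ≼-trans v≼w w≼u

  ≈-compatible-trans : Transitive (KCompatible ∩ _≈_)
  ≈-compatible-trans (v→w , v≈w) (w→u , w≈u) =
    ≼-KCompatible-trans (proj₁ v≈w) w→u , ≈-trans v≈w w≈u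

  ≈-compatible-euclidean : Euclidean (KCompatible ∩ _≈_)
  ≈-compatible-euclidean (v→w , v≈w) (v→u , v≈u) =
    ≼-KCompatible-trans (proj₂ v≈w) v→u , ≈-trans (≈-sym v≈w) v≈u

  mutual≈-sym : Symmetric (KCompatible ∩ (flip KCompatible ∩ _≈_))
  mutual≈-sym (v→w , w→v , v≈w) = w→v , v→w , ≈-sym v≈w

  mutual≈-trans : Transitive (KCompatible ∩ (flip KCompatible ∩ _≈_))
  mutual≈-trans (v→w , w→v , v≈w) (w→u , u→w , w≈u) =
    ≼-KCompatible-trans (proj₁ v≈w) w→u , ≼-KCompatible-trans (proj₂ w≈u) w→v ,
    ≈-trans v≈w w≈u

  mutual≈-euclidean : Euclidean (KCompatible ∩ (flip KCompatible ∩ _≈_))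
  mutual≈-euclidean v-w v-u = mutual≈-trans (mutual≈-sym v-w) v-u

World : VSet → Set
World Π = Σ Valuation Π

witness : ∀ {L Λ Π R v b} → IsPreModel L Λ Π R → Π v → Λ b →
          ∀ s → Possible s (v b) → ∃ λ w → Π w × R v w × Holds s (w b)
witness (_ , _ , P-witness , _)  Πv Λb pos = P-witness _ _ Πv Λb
witness (_ , _ , _ , PN-witness) Πv Λb neg = PN-witness _ _ Πv Λb

successor : ∀ {L Λ Π R v a} → IsPreModel L Λ Π R → Π v → Λ a →
            ¬ (N' (v a) × I' (v a)) → ∃ (R v)
successor {v = v} {a} pm Πv Λa ¬N×I with T? (isN (v a))
... | no ¬N = let (w , _ , r , _) = witness pm Πv Λa neg (from (Possible-opposite⇔¬Necessary pos _) ¬N)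
              in w , r
... | yes N = let (w , _ , r , _) = witness pm Πv Λa pos
                                      (from (Possible-opposite⇔¬Necessary neg _) λ I → ¬N×I (N , I))
              in w , r

module Accessibility {Λ : FSet} {Π : VSet} {R : VRel}
                     (R⇒Π² : ∀ {v w} → R v w → Π v × Π w) where
  open Marks Λ

  onEdge : {C : Valuation → Valuation → For → Set} →
           (∀ v w b → Π v → Π w → Λ b → R v w → C v w b) →
           ∀ {v w b} → R v w → Λ b → C v w b
  onEdge condition r Λb = condition _ _ _ (proj₁ (R⇒Π² r)) (proj₂ (R⇒Π² r)) Λb r

  R⇒KCompatible : ∀ {L v w} → IsKModel L Λ Π R → R v w → KCompatible v w
  R⇒KCompatible (_ , k) r pos Λb = proj₁ (onEdge k r Λb)
  R⇒KCompatible (_ , k) r neg Λb = proj₂ (onEdge k r Λb)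

  KCompatible-refl : ∀ {w} → CondT Λ Π R → Π w → KCompatible w w
  KCompatible-refl cT Πw pos Λb = proj₁ (cT _ _ Πw Λb)
  KCompatible-refl cT Πw neg Λb = proj₂ (cT _ _ Πw Λb)

  R⇒Holds⇒Possible : ∀ {v w} → CondB Λ Π R → R v w →
                     ∀ s {b} → Λ b → Holds s (v b) → Possible s (w b)
  R⇒Holds⇒Possible cB r pos Λb = proj₁ (onEdge cB r Λb)
  R⇒Holds⇒Possible cB r neg Λb = proj₂ (onEdge cB r Λb)

  R⇒converse-KCompatible : ∀ {v w} → CondB Λ Π R → R v w → KCompatible w v
  R⇒converse-KCompatible cB r s Λb Nw = decidable-stable (Holds? s _) λ ¬Hv →
    to (Possible-opposite⇔¬Necessary s _)
       (R⇒Holds⇒Possible cB r (opposite s) Λb (¬Holds⇒Holds-opposite s _ ¬Hv)) Nw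

  R⇒≼ : ∀ {v w} → Cond4 Λ Π R → R v w → v ≼ w
  R⇒≼ c4 r pos Λb = proj₁ (onEdge c4 r Λb)
  R⇒≼ c4 r neg Λb = proj₂ (onEdge c4 r Λb)

  R⇒Possible⇒Possible : ∀ {v w} → Cond5 Λ Π R → R v w →
                        ∀ s {b} → Λ b → Possible s (v b) → Possible s (w b)
  R⇒Possible⇒Possible (c5 , _) r pos Λb = proj₁ (onEdge c5 r Λb)
  R⇒Possible⇒Possible (c5 , _) r neg Λb = proj₂ (onEdge c5 r Λb)

  R⇒≽ : ∀ {v w} → Cond5 Λ Π R → R v w → w ≼ v
  R⇒≽ c5 r s Λb Nw = decidable-stable (Necessary? s _) λ ¬Nv →
    to (Possible-opposite⇔¬Necessary s _)
       (R⇒Possible⇒Possible c5 r (opposite s) Λb (from (Possible-opposite⇔¬Necessary s _) ¬Nv)) Nw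

  Π-target : ∀ {v w w'} → R v w' ⊎ R w w' → Π w'
  Π-target = [ proj₂ ∘ R⇒Π² , proj₂ ∘ R⇒Π² ]

  Necessary-spreads : ∀ {v w w'} → Cond5 Λ Π R → R v w → R v w' ⊎ R w w' → ∀ s {b} → Λ b →
                      Necessary s (v b) → Necessary s (w b) → Necessary s (w' b)
  Necessary-spreads (_ , c5) r r' pos Λb =
    proj₁ (c5 _ _ _ _ (proj₁ (R⇒Π² r)) (proj₂ (R⇒Π² r)) (Π-target r') Λb r r')
  Necessary-spreads (_ , c5) r r' neg Λb =
    proj₂ (c5 _ _ _ _ (proj₁ (R⇒Π² r)) (proj₂ (R⇒Π² r)) (Π-target r') Λb r r')

  siblings-≼ : ∀ {v u w} → Cond5 Λ Π R → R v u → R v w → u ≼ w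
  siblings-≼ c5 r₁ r₂ s Λb Nu =
    Necessary-spreads c5 r₁ (inj₁ r₂) s Λb (R⇒≽ c5 r₁ s Λb Nu) Nu

  reached-R⇒≈ : ∀ {p w x} → Cond5 Λ Π R → R p w → R w x → w ≈ x
  reached-R⇒≈ c5 r₁ r₂ =
    (λ s Λb Nw → Necessary-spreads c5 r₁ (inj₂ r₂) s Λb (R⇒≽ c5 r₁ s Λb Nw) Nw) , R⇒≽ c5 r₂

  R⇒≈ : ∀ {v w} → Cond4 Λ Π R → Cond5 Λ Π R → R v w → v ≈ w
  R⇒≈ c4 c5 r = R⇒≼ c4 r , R⇒≽ c5 r

  -- Without (4) the R-successors of v only share their marks with each other, not with v.
  -- The predecessor p is recorded because reached-R⇒≈ needs it to compare w with its own
  -- successors.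
  InClusterOf : Valuation → Valuation → Set
  InClusterOf v w = (∀ {u} → R v u → u ≈ w) × ∃ (λ p → R p w)

  R⇒InClusterOf : ∀ {v w} → Cond5 Λ Π R → R v w → InClusterOf v w
  R⇒InClusterOf c5 r = (λ r' → siblings-≼ c5 r' r , siblings-≼ c5 r r') , (_ , r)

  cluster-euclidean : ∀ {L a} → IsPreModel L Λ Π R → Cond5 Λ Π R → Λ a →
                      ∀ {v w u} → Π v → (KCompatible ∩ InClusterOf) v w →
                      (KCompatible ∩ InClusterOf) v u → (KCompatible ∩ InClusterOf) w u
  cluster-euclidean pm c5 Λa Πv (v→w , w-cluster , (p , p-w)) (v→u , u-cluster , u-reached) =
    let (v₀ , v-v₀) = successor pm Πv Λa λ (N , I) → v→w neg Λa I (v→w pos Λa N)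
        w≈v₀ = ≈-sym (w-cluster v-v₀)
        w≈u = ≈-trans w≈v₀ (u-cluster v-v₀)
    in ≼-KCompatible-trans (≼-trans (proj₁ w≈v₀) (R⇒≽ c5 v-v₀)) v→u
     , (λ w-x → ≈-trans (≈-sym (reached-R⇒≈ c5 p-w w-x)) w≈u)
     , u-reached

  Extra : Logic → Valuation → Valuation → Set
  Extra K    _ _ = ⊤
  Extra KD   _ _ = ⊤
  Extra KT   _ _ = ⊤
  Extra KB   v w = KCompatible w v
  Extra KDB  v w = KCompatible w v
  Extra KTB  v w = KCompatible w v
  Extra K4   v w = v ≼ w
  Extra KD4  v w = v ≼ w
  Extra S4   v w = v ≼ w
  Extra K5   v w = InClusterOf v w
  Extra KD5  v w = InClusterOf v w
  Extra K45  v w = v ≈ w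
  Extra KD45 v w = v ≈ w
  Extra S5   v w = KCompatible w v × v ≈ w
  Extra KB5  v w = KCompatible w v × v ≈ w

  Access : Logic → Valuation → Valuation → Set
  Access L = KCompatible ∩ Extra L

  _≺[_]_ : World Π → Logic → World Π → Set
  w ≺[ L ] u = Access L (proj₁ w) (proj₁ u)

  R⇒Extra : ∀ L {v w} → IsLModel L Λ Π R → R v w → Extra L v w
  R⇒Extra K    _ _ = tt
  R⇒Extra KD   _ _ = tt
  R⇒Extra KT   _ _ = tt
  R⇒Extra KB   (_ , _ , _ , cB , _)       r = R⇒converse-KCompatible cB r
  R⇒Extra KDB  (_ , _ , _ , cB , _)       r = R⇒converse-KCompatible cB r
  R⇒Extra KTB  (_ , _ , _ , cB , _)       r = R⇒converse-KCompatible cB r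
  R⇒Extra K4   (_ , _ , _ , _ , c4 , _)   r = R⇒≼ c4 r
  R⇒Extra KD4  (_ , _ , _ , _ , c4 , _)   r = R⇒≼ c4 r
  R⇒Extra S4   (_ , _ , _ , _ , c4 , _)   r = R⇒≼ c4 r
  R⇒Extra K5   (_ , _ , _ , _ , _ , c5)   r = R⇒InClusterOf c5 r
  R⇒Extra KD5  (_ , _ , _ , _ , _ , c5)   r = R⇒InClusterOf c5 r
  R⇒Extra K45  (_ , _ , _ , _ , c4 , c5)  r = R⇒≈ c4 c5 r
  R⇒Extra KD45 (_ , _ , _ , _ , c4 , c5)  r = R⇒≈ c4 c5 r
  R⇒Extra S5   (_ , _ , _ , cB , c4 , c5) r = R⇒converse-KCompatible cB r , R⇒≈ c4 c5 r
  R⇒Extra KB5  (_ , _ , _ , cB , c4 , c5) r = R⇒converse-KCompatible cB r , R⇒≈ c4 c5 r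

  R⇒Access : ∀ L {v w} → IsLModel L Λ Π R → R v w → Access L v w
  R⇒Access L M r = R⇒KCompatible (proj₁ M) r , R⇒Extra L M r

  serial : ∀ L → IsLModel L Λ Π R → CondD Λ Π R → ∀ {a} → Λ a → ∀ w → ∃ (w ≺[ L ]_)
  serial L M cD Λa (v , Πv) =
    let (u , r) = successor (proj₁ (proj₁ M)) Πv Λa λ (N , I) →
                    to (Possible-opposite⇔¬Necessary neg _) (proj₁ (cD _ _ Πv Λa) N) I
    in (u , proj₂ (R⇒Π² r)) , R⇒Access L M r

  frame : ∀ L → IsLModel L Λ Π R → ∀ {a} → Λ a → IsFrameFor L (_≺[ L ]_)
  frame K    _ _ = isFrameFor tt tt tt tt tt
  frame KD   M@(_ , _ , cD , _) Λa = isFrameFor tt (serial KD M cD Λa) tt tt tt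
  frame KT   (_ , cT , _) _ = isFrameFor (λ {w} → KCompatible-refl cT (proj₂ w) , tt) tt tt tt tt
  frame KB   _ _ = isFrameFor tt tt swap tt tt
  frame KDB  M@(_ , _ , cD , _) Λa = isFrameFor tt (serial KDB M cD Λa) swap tt tt
  frame KTB  (_ , cT , _) _ =
    isFrameFor (λ {w} → KCompatible-refl cT (proj₂ w) , KCompatible-refl cT (proj₂ w)) tt swap tt tt
  frame K4   _ _ = isFrameFor tt tt tt ≼-compatible-trans tt
  frame KD4  M@(_ , _ , cD , _) Λa = isFrameFor tt (serial KD4 M cD Λa) tt ≼-compatible-trans tt
  frame S4   (_ , cT , _) _ =
    isFrameFor (λ {w} → KCompatible-refl cT (proj₂ w) , ≼-refl) tt tt ≼-compatible-trans tt
  frame K5   ((pm , _) , _ , _ , _ , _ , c5) Λa =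
    isFrameFor tt tt tt tt (λ {w} → cluster-euclidean pm c5 Λa (proj₂ w))
  frame KD5  M@((pm , _) , _ , cD , _ , _ , c5) Λa =
    isFrameFor tt (serial KD5 M cD Λa) tt tt (λ {w} → cluster-euclidean pm c5 Λa (proj₂ w))
  frame K45  _ _ = isFrameFor tt tt tt ≈-compatible-trans ≈-compatible-euclidean
  frame KD45 M@(_ , _ , cD , _) Λa =
    isFrameFor tt (serial KD45 M cD Λa) tt ≈-compatible-trans ≈-compatible-euclidean
  frame S5   (_ , cT , _) _ =
    isFrameFor (λ {w} → KCompatible-refl cT (proj₂ w) , KCompatible-refl cT (proj₂ w) , ≈-refl)
               tt mutual≈-sym mutual≈-trans mutual≈-euclidean
  frame KB5  _ _ = isFrameFor tt tt mutual≈-sym mutual≈-trans mutual≈-euclidean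

-- The truth lemma

record SubformulaClosed (Λ : FSet) : Set where
  field
    ⇒-closedˡ : ∀ {b c} → Λ (b ⇒ c) → Λ b
    ⇒-closedʳ : ∀ {b c} → Λ (b ⇒ c) → Λ c
    □-closed  : ∀ {b} → Λ (□ b) → Λ b

SubOf-trans : ∀ {a b c} → SubOf a b → SubOf b c → SubOf a c
SubOf-trans a≤b sub-refl       = a≤b
SubOf-trans a≤b (sub-impl b≤c) = sub-impl (SubOf-trans a≤b b≤c)
SubOf-trans a≤b (sub-impr b≤c) = sub-impr (SubOf-trans a≤b b≤c)
SubOf-trans a≤b (sub-box b≤c)  = sub-box (SubOf-trans a≤b b≤c)

closure-closed : ∀ Γ α → SubformulaClosed (closure Γ α)
closure-closed Γ α = record
  { ⇒-closedˡ = λ (g , g∈ , sub) → g , g∈ , SubOf-trans (sub-impl sub-refl) sub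
  ; ⇒-closedʳ = λ (g , g∈ , sub) → g , g∈ , SubOf-trans (sub-impr sub-refl) sub
  ; □-closed  = λ (g , g∈ , sub) → g , g∈ , SubOf-trans (sub-box sub-refl) sub
  }

designated-atoms : {Π : VSet} → World Π → ℕ → Bool
designated-atoms (v , _) n = isD (v (var n))

module TruthLemma {L : Logic} {Λ : FSet} {Π : VSet} {R : VRel}
  (pm : IsPreModel L Λ Π R) (Λ-closed : SubformulaClosed Λ)
  (_≺_ : World Π → World Π → Set)
  (≺⇒KCompatible : ∀ {w u} → w ≺ u → Marks.KCompatible Λ (proj₁ w) (proj₁ u))
  (R⇒≺ : ∀ {v u} (Πv : Π v) (Πu : Π u) → R v u → (v , Πv) ≺ (u , Πu)) where

  open SubformulaClosed Λ-closed
  open Kripke _≺_ designated-atoms public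

  ⊥-value : ∀ {v} → Π v → Λ ⊥' → v ⊥' ∈ botSet
  ⊥-value Πv = proj₁ (proj₂ (proj₁ pm _ Πv))

  ⇒-value : ∀ {v b c} → Π v → Λ (b ⇒ c) → v (b ⇒ c) ∈ impSet (v b) (v c)
  ⇒-value Πv = proj₁ (proj₂ (proj₂ (proj₁ pm _ Πv))) _ _

  □-value : ∀ {v b} → Π v → Λ (□ b) → v (□ b) ∈ boxSet L (v b)
  □-value Πv = proj₂ (proj₂ (proj₂ (proj₁ pm _ Πv))) _

  truth : ∀ {b} → Λ b → ∀ w → w ⊩ b ⇔ Des (proj₁ w b)
  truth {var n} _ w = mk⇔ id id
  truth {⊥'} Λ⊥ (v , Πv) = mk⇔ ⊥-elim (⊥-undesignated (⊥-value Πv Λ⊥))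
  truth {b ⇒ c} Λb⇒c w@(v , Πv) =
    mk⇔ (λ f → from ⇒-table λ db → to IHc (f (from IHb db)))
        (λ d x → from IHc (to ⇒-table d (to IHb x)))
    where
    IHb = truth (⇒-closedˡ Λb⇒c) w
    IHc = truth (⇒-closedʳ Λb⇒c) w
    ⇒-table = Des-⇒ (⇒-value Πv Λb⇒c)
  truth {□ b} Λ□b w@(v , Πv) =
    mk⇔ necessary λ d w≺u → from (truth Λb _) (≺⇒KCompatible w≺u pos Λb (to □-table d))
    where
    Λb = □-closed Λ□b
    □-table = Des-□ (□-value Πv Λ□b)
    necessary : w ⊩ □ b → Des (v (□ b))
    necessary □b = from □-table (decidable-stable (T? (isN (v b))) λ ¬N →
      let (u , Πu , v-u , ¬Du) = witness pm Πv Λb neg (from (Possible-opposite⇔¬Necessary pos _) ¬N)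
      in ¬Du (to (truth Λb (u , Πu)) (□b (R⇒≺ Πv Πu v-u))))

theorem5 : (L : Logic) (Γ : FSet) (α : For) → Γ ⊢[ L ] α → Γ ⊨[ L ] α
theorem5 L Γ α Γ⊢α v (Π , R , M , Πv) Γ-designated =
  to (truth α∈Λ w₀) (⊢-sound (frame L M α∈Λ) Γ⊢α w₀ Γ-true)
  where
  pm = proj₁ (proj₁ M)
  open Accessibility (λ {v} {w} → proj₁ (proj₂ pm) v w)
  open TruthLemma pm (closure-closed Γ α) (_≺[ L ]_) proj₁ (λ _ _ → R⇒Access L M)

  α∈Λ : closure Γ α α
  α∈Λ = α , inj₂ refl , sub-refl

  w₀ : World Π
  w₀ = v , Πv

  Γ-true : ∀ {g} → Γ g → w₀ ⊩ g
  Γ-true Γg = from (truth (_ , inj₁ Γg , sub-refl) w₀) (Γ-designated _ Γg)
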